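{- The tensor product $\mathcal{A} \otimes \mathcal{B}$ is an HDA model of the interleaving $\mathcal{S} \mathbin{|||} \mathcal{T}$.
   Context: $\mathcal{S}$ and $\mathcal{T}$ are $\ltimes$-transition systems (transition systems, i.e. 1-truncated HDAs in which two edges with the same label and endpoints are equal, together with a relation $\ltimes$ on labels), and $\mathcal{A}$, $\mathcal{B}$ are HDA models of $\mathcal{S}$, $\mathcal{T}$. An HDA $\mathcal{A}$ is an HDA model of a $\ltimes$-transition system $\mathcal{T}$ if: (HM1) $\mathcal{A}_{\le1}=U(\mathcal{T})$; (HM2) for all 2-cubes $x$, $\lambda_\mathcal{A}(d^0_2x)\ltimes_\mathcal{T}\lambda_\mathcal{A}(d^0_1x)$; (HM3) for $m\ge2$, two $m$-cubes with all the same faces $d^k_r$ are equal; (HM4) $\mathcal{A}$ is not a proper subautomaton of any HDA satisfying HM1–HM3. $\mathcal{A}\otimes\mathcal{B}$ is the tensor product of HDAs (tensor product of precubical sets, initial state $(I_\mathcal{A},I_\mathcal{B})$, final states $F_\mathcal{A}\times F_\mathcal{B}$, labels $\Sigma_\mathcal{A}\amalg\Sigma_\mathcal{B}$, edge $(x,y)$ labeled by the label of its 1-dimensional component). $\mathcal{S}\mathbin{|||}\mathcal{T}$ is the interleaving: underlying transition system $(U(\mathcal{S})\otimes U(\mathcal{T}))_{\le1}$, with $\alpha\ltimes\beta$ iff either $\alpha,\beta\in\Sigma_\mathcal{S}$ and $\alpha\ltimes_\mathcal{S}\beta$, or $\alpha,\beta\in\Sigma_\mathcal{T}$ and $\alpha\ltimes_\mathcal{T}\beta$,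 or $\alpha\in\Sigma_\mathcal{S}$ and $\beta\in\Sigma_\mathcal{T}$. -}

module Defs where

open import Data.Nat using (ℕ; zero; suc; _+_; _≤_)
open import Data.Nat.Properties using (+-suc)
open import Data.Fin using (Fin; zero; suc; toℕ; inject₁; splitAt)
open import Data.Bool using (Bool; true; false)
open import Data.Empty using (⊥)
open import Data.Unit using (⊤)
open import Data.Sum using (_⊎_; inj₁; inj₂)
open import Data.Product using (Σ; _×_; _,_; proj₁; proj₂)
open import Data.Sum.Properties using (inj₁-injective; inj₂-injective)
open import Relation.Nullary using (¬_)
open import Relation.Binary.PropositionalEquality using (_≡_; refl; sym; cong)
open import Function.Bundles using (_↔_; _⇔_; Inverse)

-- Conventions
--  * face indices are 0-based: the paper's d^k_r (r = 1..n+1) on (n+1)-cubes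
--    is  face k (r-1) ; k = false stands for 0, k = true stands for 1.
--  * d^0 of an edge is its source, d^1 its target.

record RawHDA (Lab : Set) : Set₁ where
  field
    Cube  : ℕ → Set
    face  : ∀ {n} → Bool → Fin (suc n) → Cube (suc n) → Cube n
    init  : Cube 0
    Final : Cube 0 → Set
    lab   : Cube 1 → Lab

-- The axioms making a RawHDA an HDA: precubical identities
--   d^k_r d^l_s = d^l_{s-1} d^k_r   (r < s, 1-based)
-- and the labelling condition  λ(d^0_i x) = λ(d^1_i x)  for 2-cubes x.
record IsHDA {Lab : Set} (A : RawHDA Lab) : Set where
  open RawHDA A
  field
    cubical : ∀ {n} (k l : Bool) (r s : Fin (suc n)) (x : Cube (suc (suc n))) →
              toℕ r ≤ toℕ s →
              face k r (face l (suc s) x) ≡ face l s (face k (inject₁ r) x)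
    lab-coh : ∀ (i : Fin 2) (x : Cube 2) → lab (face false i x) ≡ lab (face true i x)

record HDAHom {Lab : Set} (A C : RawHDA Lab) : Set where
  private
    module A = RawHDA A
    module C = RawHDA C
  field
    map       : ∀ n → A.Cube n → C.Cube n
    map-face  : ∀ {n} k i (x : A.Cube (suc n)) → map n (A.face k i x) ≡ C.face k i (map (suc n) x)
    map-init  : map 0 A.init ≡ C.init
    map-final : ∀ x → A.Final x → C.Final (map 0 x)
    map-lab   : ∀ x → C.lab (map 1 x) ≡ A.lab x

-- A is a subautomaton of C via an injective morphism (embedding) ...
record Embedding {Lab : Set} (A C : RawHDA Lab) : Set where
  field
    hom       : HDAHom A C
    injective : ∀ n (x y : RawHDA.Cube A n) → HDAHom.map hom n x ≡ HDAHom.map hom n y → x ≡ y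

Proper : {Lab : Set} {A C : RawHDA Lab} → Embedding A C → Set
Proper {A = A} {C} e =
  Σ ℕ λ n → Σ (RawHDA.Cube C n) λ c →
    ¬ (Σ (RawHDA.Cube A n) λ a → HDAHom.map (Embedding.hom e) n a ≡ c)

record HDAIso {Lab : Set} (A B : RawHDA Lab) : Set where
  private
    module A = RawHDA A
    module B = RawHDA B
  field
    iso       : ∀ n → A.Cube n ↔ B.Cube n
  to : ∀ n → A.Cube n → B.Cube n
  to n = Inverse.to (iso n)
  field
    iso-face  : ∀ {n} k i (x : A.Cube (suc n)) → to n (A.face k i x) ≡ B.face k i (to (suc n) x)
    iso-init  : to 0 A.init ≡ B.init
    iso-final : ∀ x → A.Final x ⇔ B.Final (to 0 x)
    iso-lab   : ∀ x → B.lab (to 1 x) ≡ A.lab x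

trunc1 : {Lab : Set} → RawHDA Lab → RawHDA Lab
trunc1 {Lab} A = record
  { Cube = C ; face = f ; init = A.init ; Final = A.Final ; lab = A.lab }
  where
  module A = RawHDA A
  C : ℕ → Set
  C zero = A.Cube 0
  C (suc zero) = A.Cube 1
  C (suc (suc n)) = ⊥
  f : ∀ {n} → Bool → Fin (suc n) → C (suc n) → C n
  f {zero} k i x = A.face k i x
  f {suc n} k i ()

record LTS : Set₁ where
  field
    Lab    : Set
    State  : Set
    Edge   : Set
    src    : Edge → State
    tgt    : Edge → State
    init   : State
    Final  : State → Set
    lab    : Edge → Lab
    unique : ∀ e e' → src e ≡ src e' → tgt e ≡ tgt e' → lab e ≡ lab e' → e ≡ e'
    _⋉_    : Lab → Lab → Set

U : (T : LTS) → RawHDA (LTS.Lab T)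
U T = record { Cube = C ; face = f ; init = T.init ; Final = T.Final ; lab = T.lab }
  where
  module T = LTS T
  C : ℕ → Set
  C zero = T.State
  C (suc zero) = T.Edge
  C (suc (suc n)) = ⊥
  f : ∀ {n} → Bool → Fin (suc n) → C (suc n) → C n
  f {zero} false zero e = T.src e
  f {zero} true  zero e = T.tgt e
  f {suc n} k i ()

HM3 : {Lab : Set} → RawHDA Lab → Set
HM3 A = ∀ m (x y : Cube (suc (suc m))) →
          (∀ k r → face k r x ≡ face k r y) → x ≡ y
  where open RawHDA A

HM2 : (T : LTS) → RawHDA (LTS.Lab T) → Set
HM2 T A = ∀ (x : Cube 2) → LTS._⋉_ T (lab (face false (suc zero) x)) (lab (face false zero x))
  where open RawHDA A

HM1 : (T : LTS) → RawHDA (LTS.Lab T) → Set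
HM1 T A = HDAIso (trunc1 A) (U T)

-- An embedding A ↪ C between HDAs satisfying HM1 is a subautomaton
-- inclusion compatible with the identifications of A_{≤1} and C_{≤1} with U(T)
-- (i.e. the identity on 0- and 1-cubes).
Compatible : (T : LTS) {A C : RawHDA (LTS.Lab T)} →
             HM1 T A → HM1 T C → Embedding A C → Set
Compatible T {A} {C} hA hC e =
  (∀ x → HDAIso.to hC 0 (m 0 x) ≡ HDAIso.to hA 0 x) ×
  (∀ x → HDAIso.to hC 1 (m 1 x) ≡ HDAIso.to hA 1 x)
  where m = HDAHom.map (Embedding.hom e)

record IsHDAModel (T : LTS) (A : RawHDA (LTS.Lab T)) : Set₁ where
  field
    isHDA : IsHDA A
    hm1   : HM1 T A
    hm2   : HM2 T A
    hm3   : HM3 A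
    hm4   : ¬ (Σ (RawHDA (LTS.Lab T)) λ C → Σ (IsHDA C) λ _ → Σ (HM1 T C) λ hC →
                 Σ (HM2 T C) λ _ → Σ (HM3 C) λ _ → Σ (Embedding A C) λ e →
                 Compatible T hm1 hC e × Proper e)

record TCube (X Y : ℕ → Set) (n : ℕ) : Set where
  constructor tc
  field
    p  : ℕ
    q  : ℕ
    eq : p + q ≡ n
    x  : X p
    y  : Y q

module _ {Σ₁ Σ₂ : Set} (A : RawHDA Σ₁) (B : RawHDA Σ₂) where
  private
    module A = RawHDA A
    module B = RawHDA B
    TC = TCube A.Cube B.Cube

    faceR : ∀ p q → Bool → A.Cube (suc p) → B.Cube q → Fin (suc p) ⊎ Fin q → TC (p + q)
    faceR p q k x y (inj₁ j) = tc p q refl (A.face k j x) y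
    faceR p zero k x y (inj₂ ())
    faceR p (suc q) k x y (inj₂ j) = tc (suc p) q (sym (+-suc p q)) x (B.face k j y)

    tface : ∀ {n} → Bool → Fin (suc n) → TC (suc n) → TC n
    tface {n} k i (tc zero .(suc n) refl x y) = tc zero n refl x (B.face k i y)
    tface k i (tc (suc p) q refl x y) = faceR p q k x y (splitAt (suc p) i)

    tfinal : TC 0 → Set
    tfinal (tc zero zero refl x y) = A.Final x × B.Final y
    tfinal (tc zero (suc q) () x y)
    tfinal (tc (suc p) q () x y)

    tlab : TC 1 → Σ₁ ⊎ Σ₂
    tlab (tc zero .1 refl x y) = inj₂ (B.lab y)
    tlab (tc (suc zero) zero refl x y) = inj₁ (A.lab x)
    tlab (tc (suc zero) (suc q) () x y)
    tlab (tc (suc (suc p)) q () x y)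

  infixl 6 _⊗_
  _⊗_ : RawHDA (Σ₁ ⊎ Σ₂)
  _⊗_ = record
    { Cube = TC ; face = tface ; init = tc 0 0 refl A.init B.init
    ; Final = tfinal ; lab = tlab }

-- Interleaving S ||| T :  underlying transition system (U(S) ⊗ U(T))_{≤1},
-- written out: states S × T, edges (E_S × T) ⊎ (S × E_T).

module _ (S T : LTS) where
  private
    module S = LTS S
    module T = LTS T
    E = (S.Edge × T.State) ⊎ (S.State × T.Edge)
    isrc : E → S.State × T.State
    isrc (inj₁ (e , t)) = S.src e , t
    isrc (inj₂ (s , e)) = s , T.src e
    itgt : E → S.State × T.State
    itgt (inj₁ (e , t)) = S.tgt e , t
    itgt (inj₂ (s , e)) = s , T.tgt e
    ilab : E → S.Lab ⊎ T.Lab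
    ilab (inj₁ (e , t)) = inj₁ (S.lab e)
    ilab (inj₂ (s , e)) = inj₂ (T.lab e)
    ifin : S.State × T.State → Set
    ifin (s , t) = S.Final s × T.Final t
    irel : S.Lab ⊎ T.Lab → S.Lab ⊎ T.Lab → Set
    irel (inj₁ a) (inj₁ b) = S._⋉_ a b
    irel (inj₂ a) (inj₂ b) = T._⋉_ a b
    irel (inj₁ a) (inj₂ b) = ⊤
    irel (inj₂ a) (inj₁ b) = ⊥
    iuniq : ∀ e e' → isrc e ≡ isrc e' → itgt e ≡ itgt e' → ilab e ≡ ilab e' → e ≡ e'
    iuniq (inj₁ (e , t)) (inj₁ (e' , t')) p q r
      rewrite S.unique e e' (cong proj₁ p) (cong proj₁ q) (inj₁-injective r)
            | cong proj₂ p = refl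
    iuniq (inj₂ (s , e)) (inj₂ (s' , e')) p q r
      rewrite T.unique e e' (cong proj₂ p) (cong proj₂ q) (inj₂-injective r)
            | cong proj₁ p = refl
    iuniq (inj₁ _) (inj₂ _) p q ()
    iuniq (inj₂ _) (inj₁ _) p q ()

  infixl 5 _|||_
  _|||_ : LTS
  _|||_ = record
    { Lab = S.Lab ⊎ T.Lab ; State = S.State × T.State ; Edge = E
    ; src = isrc ; tgt = itgt ; init = S.init , T.init ; Final = ifin
    ; lab = ilab ; unique = iuniq ; _⋉_ = irel }

module Submission where

open import Defs
open import Data.Nat using (ℕ; zero; suc; _+_; _≤_; _<_; z≤n; s≤s)
open import Data.Nat.Properties
open import Data.Fin using (Fin; zero; suc; toℕ; inject₁; fromℕ; fromℕ<; _↑ˡ_; _↑ʳ_)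
open import Data.Fin.Properties
  using (≤fromℕ; toℕ-injective; toℕ-↑ˡ; toℕ-↑ʳ; splitAt-↑ˡ; splitAt-↑ʳ; toℕ-inject₁; toℕ-fromℕ; toℕ-fromℕ<; toℕ<n)
open import Data.Fin.Relation.Unary.Top using (view; ‵fromℕ; ‵inject₁)
open import Data.Bool using (Bool; true; false)
open import Data.Empty using (⊥-elim)
open import Data.Unit using (⊤; tt)
open import Data.Sum using (_⊎_; inj₁; inj₂; [_,_]; [_,_]′)
open import Data.Sum.Properties using (inj₁-injective; inj₂-injective)
open import Data.Product using (Σ; _×_; _,_; proj₁; proj₂)
open import Function.Bundles using (_↔_; Inverse; Injection; mk↔ₛ′)
open import Function.Properties.Inverse using (↔⇒↣; ↔-trans)
open import Data.Product.Function.NonDependent.Propositional using (_×-↔_; _×-⇔_)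
open import Data.Sum.Function.Propositional using (_⊎-↔_)
open import Function.Base using (_∘_)
open import Relation.Nullary using (¬_)
open import Relation.Nullary.Negation using (¬¬-map)
open import Relation.Binary.PropositionalEquality hiding ([_])

-- For an HDA satisfying HM1–HM3, maximality (HM4) amounts to: every shell, i.e. every
-- compatible family of faces of a would-be cube of dimension ≥ 2 (in dimension 2 also
-- respecting lab-coh and HM2), has a filler.  A shell without filler could be adjoined
-- as a new cube; conversely, in a proper extension a cube of least dimension outside the
-- image has its whole boundary inside it (the argument runs under a double negation,
-- since lying in the image is not decidable).  So it suffices to fill shells in A ⊗ B.
--
-- A cube of A ⊗ B is an A-cube paired with a B-cube.  If the face d⁰₁ of a shell has no
-- B-direction, the whole shell lies in A × {w} and is filled in A; dually, if its last
-- face d⁰ has no A-direction, it is filled in B.  Otherwise these two faces glue to a cube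
-- α = (a , b) with directions of both kinds, and the precubical identities together with
-- HM3 make every face of α the corresponding face of the shell.  In a square the label
-- of an edge tells its factor: ⋉ of S ||| T excludes one orientation of a mixed square,
-- and the other is filled by the product of an S-edge and a T-edge, which HM1 determines
-- from their endpoints and labels.

¬¬-∀-Bool : {P : Bool → Set} → (∀ b → ¬ ¬ P b) → ¬ ¬ (∀ b → P b)
¬¬-∀-Bool h k = h false λ pf → h true λ pt → k λ { false → pf ; true → pt }

¬¬-∀-Fin : ∀ m {P : Fin m → Set} → (∀ i → ¬ ¬ P i) → ¬ ¬ (∀ i → P i)
¬¬-∀-Fin zero    h k = k λ ()
¬¬-∀-Fin (suc m) h k =
  h zero λ p0 → ¬¬-∀-Fin m (λ i → h (suc i)) λ ps → k λ { zero → p0 ; (suc i) → ps i }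

↔-triangle⇒surjective : {X Y Z : Set} (f : X ↔ Z) (h : Y ↔ Z) (ι : X → Y) →
                        (∀ x → Inverse.to h (ι x) ≡ Inverse.to f x) → ∀ y → Σ X λ x → ι x ≡ y
↔-triangle⇒surjective f h ι tri y = x , Injection.injective (↔⇒↣ h) (begin
    Inverse.to h (ι x)  ≡⟨ tri x ⟩
    Inverse.to f x      ≡⟨ Inverse.strictlyInverseˡ f _ ⟩
    Inverse.to h y      ∎)
  where
  open ≡-Reasoning
  x = Inverse.from f (Inverse.to h y)

⊎-absurdʳ-↔ : {A P Y : Set} → ¬ P → A ↔ Y → (A ⊎ P) ↔ Y
⊎-absurdʳ-↔ ¬p f = mk↔ₛ′ to (inj₁ ∘ Inverse.from f) (Inverse.strictlyInverseˡ f) from∘to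
  where
  to = [ Inverse.to f , ⊥-elim ∘ ¬p ]
  from∘to : ∀ x → inj₁ (Inverse.from f (to x)) ≡ x
  from∘to (inj₁ a) = cong inj₁ (Inverse.strictlyInverseʳ f a)
  from∘to (inj₂ p) = ⊥-elim (¬p p)

split-< : ∀ p q m → m < p + q → (Σ (Fin p) λ j → m ≡ toℕ j) ⊎ (Σ (Fin q) λ j → m ≡ p + toℕ j)
split-< zero    q m       m<q       = inj₂ (fromℕ< m<q , sym (toℕ-fromℕ< m<q))
split-< (suc p) q zero    _         = inj₁ (zero , refl)
split-< (suc p) q (suc m) (s≤s m<n) with split-< p q m m<n
... | inj₁ (j , m≡j)   = inj₁ (suc j , cong suc m≡j)
... | inj₂ (j , m≡p+j) = inj₂ (j , cong suc m≡p+j)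

summand-positive : ∀ p q {n} → p + q ≡ suc n → 0 < p ⊎ 0 < q
summand-positive (suc p) q     _    = inj₁ (s≤s z≤n)
summand-positive zero    q refl = inj₂ (s≤s z≤n)

fin-lower : ∀ {m n} (i : Fin m) (j : Fin n) → toℕ i ≤ toℕ j → Σ (Fin n) λ i' → toℕ i ≡ toℕ i'
fin-lower i j i≤j = fromℕ< (≤-<-trans i≤j (toℕ<n j)) , sym (toℕ-fromℕ< _)

toℕ-inject₁-cong : ∀ {m n} {i : Fin m} {j : Fin n} → toℕ i ≡ toℕ j → toℕ (inject₁ i) ≡ toℕ (inject₁ j)
toℕ-inject₁-cong {i = i} {j} i≡j = trans (toℕ-inject₁ i) (trans i≡j (sym (toℕ-inject₁ j)))

module _ {L : Set} (D : RawHDA L) where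
  open RawHDA D

  Shell : ℕ → Set
  Shell n = Bool → Fin (suc (suc n)) → Cube (suc n)

  IsShell : ∀ {n} → Shell n → Set
  IsShell {n} g = ∀ k l (r s : Fin (suc n)) → toℕ r ≤ toℕ s →
                  face k r (g l (suc s)) ≡ face l s (g k (inject₁ r))

  Filler : ∀ {n} → Shell n → Set
  Filler {n} g = Σ (Cube (suc (suc n))) λ x → ∀ k i → face k i x ≡ g k i

WellLabelled : (X : LTS) (D : RawHDA (LTS.Lab X)) → ∀ {n} → Shell D n → Set
WellLabelled X D {zero} g =
  (∀ i → lab (g false i) ≡ lab (g true i)) × LTS._⋉_ X (lab (g false (suc zero))) (lab (g false zero))
  where open RawHDA D
WellLabelled X D {suc n} g = ⊤

module _ {L : Set} {D : RawHDA L} {n : ℕ} {g h : Shell D n} (g≗h : ∀ k i → g k i ≡ h k i) where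
  open RawHDA D

  IsShell-resp : IsShell D g → IsShell D h
  IsShell-resp shell k l r s r≤s =
    subst₂ (λ u v → face k r u ≡ face l s v) (g≗h l (suc s)) (g≗h k (inject₁ r)) (shell k l r s r≤s)

  Filler-resp : Filler D g → Filler D h
  Filler-resp (x , x-fills) = x , λ k i → trans (x-fills k i) (g≗h k i)

WellLabelled-resp : ∀ {X D n} {g h : Shell D n} → (∀ k i → g k i ≡ h k i) → WellLabelled X D g → WellLabelled X D h
WellLabelled-resp {X} {D} {zero} g≗h (lab-coh , ⋉) =
  (λ i → subst₂ (λ u v → lab u ≡ lab v) (g≗h false i) (g≗h true i) (lab-coh i)) ,
  subst₂ (λ u v → LTS._⋉_ X (lab u) (lab v)) (g≗h false (suc zero)) (g≗h false zero) ⋉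
  where open RawHDA D
WellLabelled-resp {n = suc n} g≗h tt = tt

module _ {L : Set} {D : RawHDA L} {n : ℕ} {g h : Shell D n} (g-shell : IsShell D g) (h-shell : IsShell D h) where
  open RawHDA D

  agree-at-inject₁⇒faces-agree : ∀ k l (r s : Fin (suc n)) → toℕ r ≤ toℕ s → g k (inject₁ r) ≡ h k (inject₁ r) →
                                 face k r (g l (suc s)) ≡ face k r (h l (suc s))
  agree-at-inject₁⇒faces-agree k l r s r≤s agree =
    trans (g-shell k l r s r≤s) (trans (cong (face l s) agree) (sym (h-shell k l r s r≤s)))

  agree-at-suc⇒faces-agree : ∀ k l (r s : Fin (suc n)) → toℕ r ≤ toℕ s → g l (suc s) ≡ h l (suc s) →
                             face l s (g k (inject₁ r)) ≡ face l s (h k (inject₁ r))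
  agree-at-suc⇒faces-agree k l r s r≤s agree =
    trans (sym (g-shell k l r s r≤s)) (trans (cong (face k r) agree) (h-shell k l r s r≤s))

square : ∀ {L} (D : RawHDA L) → (c₀₀ c₀₁ c₁₀ c₁₁ : RawHDA.Cube D 1) → Shell D 0
square D c₀₀ c₀₁ c₁₀ c₁₁ false zero       = c₀₀
square D c₀₀ c₀₁ c₁₀ c₁₁ false (suc zero) = c₀₁
square D c₀₀ c₀₁ c₁₀ c₁₁ true  zero       = c₁₀
square D c₀₀ c₀₁ c₁₀ c₁₁ true  (suc zero) = c₁₁

square-corner : ∀ {L} (D : RawHDA L) (g : Shell D 0) → IsShell D g → ∀ k l →
                RawHDA.face D k zero (g l (suc zero)) ≡ RawHDA.face D l zero (g k zero)
square-corner D g shell k l = shell k l zero zero z≤n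

square-η : ∀ {L} {D : RawHDA L} (g : Shell D 0) → ∀ k i →
           g k i ≡ square D (g false zero) (g false (suc zero)) (g true zero) (g true (suc zero)) k i
square-η g false zero       = refl
square-η g false (suc zero) = refl
square-η g true  zero       = refl
square-η g true  (suc zero) = refl

FillsShells : (X : LTS) (D : RawHDA (LTS.Lab X)) → Set
FillsShells X D = ∀ {n} (g : Shell D n) → IsShell D g → WellLabelled X D g → ¬ ¬ Filler D g

HM4 : (X : LTS) (D : RawHDA (LTS.Lab X)) → HM1 X D → Set₁
HM4 X D hD = ¬ (Σ (RawHDA (LTS.Lab X)) λ C → Σ (IsHDA C) λ _ → Σ (HM1 X C) λ hC →
                    Σ (HM2 X C) λ _ → Σ (HM3 C) λ _ → Σ (Embedding D C) λ e →
                    Compatible X hD hC e × Proper e)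

-- Filling shells is maximality

module Adjoin (X : LTS) (D : RawHDA (LTS.Lab X)) {n : ℕ} (g : Shell D n) where
  private
    module D = RawHDA D

  AdjCube : ℕ → Set
  AdjCube m = D.Cube m ⊎ m ≡ suc (suc n)

  adj-face : ∀ {m} → Bool → Fin (suc m) → AdjCube (suc m) → AdjCube m
  adj-face k i (inj₁ x)    = inj₁ (D.face k i x)
  adj-face k i (inj₂ refl) = inj₁ (g k i)

  adj-final : AdjCube 0 → Set
  adj-final (inj₁ x) = D.Final x

  adj-lab : AdjCube 1 → LTS.Lab X
  adj-lab (inj₁ x) = D.lab x

  adjoin : RawHDA (LTS.Lab X)
  adjoin = record
    { Cube = AdjCube ; face = adj-face ; init = inj₁ D.init ; Final = adj-final ; lab = adj-lab }

  inclusion : Embedding D adjoin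
  inclusion = record
    { hom       = record { map = λ _ → inj₁ ; map-face = λ _ _ _ → refl ; map-init = refl
                         ; map-final = λ _ f → f ; map-lab = λ _ → refl }
    ; injective = λ _ _ _ → inj₁-injective }

  inclusion-proper : Proper inclusion
  inclusion-proper = suc (suc n) , inj₂ refl , λ { (_ , ()) }

  adjoin-isHDA : IsHDA D → IsShell D g → WellLabelled X D g → IsHDA adjoin
  adjoin-isHDA isD shell wl = record { cubical = cubical ; lab-coh = lab-coh }
    where
    cubical : ∀ {m} k l (r s : Fin (suc m)) (x : AdjCube (suc (suc m))) → toℕ r ≤ toℕ s →
              adj-face k r (adj-face l (suc s) x) ≡ adj-face l s (adj-face k (inject₁ r) x)
    cubical k l r s (inj₁ x)    r≤s = cong inj₁ (IsHDA.cubical isD k l r s x r≤s)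
    cubical k l r s (inj₂ refl) r≤s = cong inj₁ (shell k l r s r≤s)
    lab-coh : ∀ i (x : AdjCube 2) → adj-lab (adj-face false i x) ≡ adj-lab (adj-face true i x)
    lab-coh i (inj₁ x)    = IsHDA.lab-coh isD i x
    lab-coh i (inj₂ refl) = proj₁ wl i

  adjoin-hm1 : HM1 X D → HM1 X adjoin
  adjoin-hm1 hD = record
    { iso       = iso
    ; iso-face  = iso-face
    ; iso-init  = HDAIso.iso-init hD
    ; iso-final = λ { (inj₁ x) → HDAIso.iso-final hD x }
    ; iso-lab   = λ { (inj₁ x) → HDAIso.iso-lab hD x } }
    where
    iso : ∀ m → RawHDA.Cube (trunc1 adjoin) m ↔ RawHDA.Cube (U X) m
    iso zero          = ⊎-absurdʳ-↔ (λ ()) (HDAIso.iso hD 0)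
    iso (suc zero)    = ⊎-absurdʳ-↔ (λ ()) (HDAIso.iso hD 1)
    iso (suc (suc m)) = mk↔ₛ′ (λ ()) (λ ()) (λ ()) (λ ())
    iso-face : ∀ {m} k i (x : RawHDA.Cube (trunc1 adjoin) (suc m)) →
               Inverse.to (iso m) (RawHDA.face (trunc1 adjoin) {m} k i x)
                 ≡ RawHDA.face (U X) {m} k i (Inverse.to (iso (suc m)) x)
    iso-face {zero} k i (inj₁ x) = HDAIso.iso-face hD k i x

  adjoin-hm2 : HM2 X D → WellLabelled X D g → HM2 X adjoin
  adjoin-hm2 hD wl (inj₁ x)    = hD x
  adjoin-hm2 hD wl (inj₂ refl) = proj₂ wl

  adjoin-hm3 : HM3 D → ¬ Filler D g → HM3 adjoin
  adjoin-hm3 hD ¬fill m (inj₁ x)    (inj₁ y)    same = cong inj₁ (hD m x y (λ k r → inj₁-injective (same k r)))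
  adjoin-hm3 hD ¬fill m (inj₁ x)    (inj₂ refl) same = ⊥-elim (¬fill (x , λ k r → inj₁-injective (same k r)))
  adjoin-hm3 hD ¬fill m (inj₂ refl) (inj₁ y)    same = ⊥-elim (¬fill (y , λ k r → inj₁-injective (sym (same k r))))
  adjoin-hm3 hD ¬fill m (inj₂ refl) (inj₂ refl) same = refl

model⇒fillsShells : ∀ {X D} → IsHDAModel X D → FillsShells X D
model⇒fillsShells {X} {D} hD g shell wl ¬fill = IsHDAModel.hm4 hD
  ( adjoin , adjoin-isHDA isHDA shell wl , adjoin-hm1 hm1 , adjoin-hm2 hm2 wl , adjoin-hm3 hm3 ¬fill
  , inclusion , ((λ _ → refl) , (λ _ → refl)) , inclusion-proper )
  where
  open IsHDAModel hD
  open Adjoin X D g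

fillsShells⇒hm4 : ∀ {X D} (hD : HM1 X D) → FillsShells X D → HM4 X D hD
fillsShells⇒hm4 {X} {D} hD fills (C , isC , hC , hm2C , hm3C , e , (compat₀ , compat₁) , (N , c , c∉)) =
  inImage N c c∉
  where
  module C = RawHDA C
  module D = RawHDA D
  open HDAHom (Embedding.hom e) using (map; map-face; map-lab)
  open ≡-Reasoning

  InImage : ∀ m → C.Cube m → Set
  InImage m c = Σ (D.Cube m) λ x → map m x ≡ c

  Preimages : ∀ {m} → C.Cube (suc (suc m)) → Set
  Preimages {m} c = ∀ k i → InImage (suc m) (C.face k i c)

  boundary : ∀ {m} {c : C.Cube (suc (suc m))} → Preimages c → Shell D m
  boundary pre k i = proj₁ (pre k i)

  boundary-isShell : ∀ {m} (c : C.Cube (suc (suc m))) (pre : Preimages c) → IsShell D (boundary pre)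
  boundary-isShell {m} c pre k l r s r≤s = Embedding.injective e m _ _ (begin
    map m (D.face k r (g l (suc s)))         ≡⟨ map-face k r _ ⟩
    C.face k r (map (suc m) (g l (suc s)))   ≡⟨ cong (C.face k r) (proj₂ (pre l (suc s))) ⟩
    C.face k r (C.face l (suc s) c)          ≡⟨ IsHDA.cubical isC k l r s c r≤s ⟩
    C.face l s (C.face k (inject₁ r) c)      ≡⟨ cong (C.face l s) (proj₂ (pre k (inject₁ r))) ⟨
    C.face l s (map (suc m) (g k (inject₁ r))) ≡⟨ map-face l s _ ⟨
    map m (D.face l s (g k (inject₁ r)))     ∎)
    where g = boundary pre

  boundary-wellLabelled : ∀ {m} (c : C.Cube (suc (suc m))) (pre : Preimages c) → WellLabelled X D (boundary pre)
  boundary-wellLabelled {suc m} c pre = tt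
  boundary-wellLabelled {zero}  c pre = lab-coh , subst₂ (LTS._⋉_ X) (lab≡ false (suc zero)) (lab≡ false zero) (hm2C c)
    where
    lab≡ : ∀ k i → C.lab (C.face k i c) ≡ D.lab (boundary pre k i)
    lab≡ k i = trans (cong C.lab (sym (proj₂ (pre k i)))) (map-lab _)
    lab-coh : ∀ i → D.lab (boundary pre false i) ≡ D.lab (boundary pre true i)
    lab-coh i = trans (sym (lab≡ false i)) (trans (IsHDA.lab-coh isC i c) (lab≡ true i))

  filler⇒inImage : ∀ {m} (c : C.Cube (suc (suc m))) (pre : Preimages c) → Filler D (boundary pre) → InImage _ c
  filler⇒inImage {m} c pre (x , x-fills) = x , hm3C m (map _ x) c λ k r → begin
    C.face k r (map _ x)         ≡⟨ map-face k r x ⟨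
    map _ (D.face k r x)         ≡⟨ cong (map _) (x-fills k r) ⟩
    map _ (boundary pre k r)     ≡⟨ proj₂ (pre k r) ⟩
    C.face k r c                 ∎

  inImage : ∀ m (c : C.Cube m) → ¬ ¬ InImage m c
  inImage zero          c ¬im = ¬im (↔-triangle⇒surjective (HDAIso.iso hD 0) (HDAIso.iso hC 0) (map 0) compat₀ c)
  inImage (suc zero)    c ¬im = ¬im (↔-triangle⇒surjective (HDAIso.iso hD 1) (HDAIso.iso hC 1) (map 1) compat₁ c)
  inImage (suc (suc m)) c ¬im =
    ¬¬-∀-Bool (λ k → ¬¬-∀-Fin _ λ i → inImage (suc m) (C.face k i c)) λ pre →
    fills (boundary pre) (boundary-isShell c pre) (boundary-wellLabelled c pre) λ fill →
    ¬im (filler⇒inImage c pre fill)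

hm1⇒edge-unique : ∀ {X D} → HM1 X D → ∀ (x y : RawHDA.Cube D 1) →
                  RawHDA.face D false zero x ≡ RawHDA.face D false zero y →
                  RawHDA.face D true zero x ≡ RawHDA.face D true zero y →
                  RawHDA.lab D x ≡ RawHDA.lab D y → x ≡ y
hm1⇒edge-unique {X} {D} hD x y src≡ tgt≡ lab≡ =
  Injection.injective (↔⇒↣ (HDAIso.iso hD 1))
    (LTS.unique X _ _ (endpoint≡ false src≡) (endpoint≡ true tgt≡)
      (trans (HDAIso.iso-lab hD x) (trans lab≡ (sym (HDAIso.iso-lab hD y)))))
  where
  open HDAIso hD using (to; iso-face)
  endpoint≡ : ∀ k → RawHDA.face D k zero x ≡ RawHDA.face D k zero y →
              RawHDA.face (U X) {0} k zero (to 1 x) ≡ RawHDA.face (U X) {0} k zero (to 1 y)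
  endpoint≡ k eq = trans (sym (iso-face k zero x)) (trans (cong (to 0) eq) (iso-face k zero y))

module Tensor {Σ₁ Σ₂ : Set} (A : RawHDA Σ₁) (B : RawHDA Σ₂) where
  private
    module A = RawHDA A
    module B = RawHDA B

  TC : ℕ → Set
  TC = TCube A.Cube B.Cube

  face⊗ : ∀ {n} → Bool → Fin (suc n) → TC (suc n) → TC n
  face⊗ = RawHDA.face (A ⊗ B)

  lab⊗ : TC 1 → Σ₁ ⊎ Σ₂
  lab⊗ = RawHDA.lab (A ⊗ B)

  -- The length equation stored in a cube is irrelevant (ℕ is a set); tc-cong forgets it.
  module _ {n p q : ℕ} {e e' : p + q ≡ n} {x x' : A.Cube p} {y y' : B.Cube q} where

    tc-cong : x ≡ x' → y ≡ y' → tc {A.Cube} {B.Cube} p q e x y ≡ tc p q e' x' y'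
    tc-cong refl refl = cong (λ e → tc p q e x y) (≡-irrelevant e e')

    tc-injective-x : tc {A.Cube} {B.Cube} p q e x y ≡ tc p q e' x' y' → x ≡ x'
    tc-injective-x refl = refl

    tc-injective-y : tc {A.Cube} {B.Cube} p q e x y ≡ tc p q e' x' y' → y ≡ y'
    tc-injective-y refl = refl

  module _ {n p q p' q' : ℕ} {e : p + q ≡ n} {e' : p' + q' ≡ n}
           {x : A.Cube p} {x' : A.Cube p'} {y : B.Cube q} {y' : B.Cube q'} where

    tc-injective-p : tc {A.Cube} {B.Cube} p q e x y ≡ tc p' q' e' x' y' → p ≡ p'
    tc-injective-p refl = refl

    tc-injective-q : tc {A.Cube} {B.Cube} p q e x y ≡ tc p' q' e' x' y' → q ≡ q'
    tc-injective-q refl = refl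

  face-⊗ˡ : ∀ {n p q} (e : suc p + q ≡ suc n) {x y} k (i : Fin (suc n)) (j : Fin (suc p)) →
            toℕ i ≡ toℕ j → face⊗ k i (tc (suc p) q e x y) ≡ tc p q (suc-injective e) (A.face k j x) y
  face-⊗ˡ {q = q} refl k i j i≡j
    with refl ← toℕ-injective {i = i} {j = j ↑ˡ q} (trans i≡j (sym (toℕ-↑ˡ j q)))
    rewrite splitAt-↑ˡ (suc _) j q = refl

  face-⊗ʳ : ∀ {n p q} (e : p + suc q ≡ suc n) {x y} k (i : Fin (suc n)) (j : Fin (suc q)) →
            toℕ i ≡ p + toℕ j →
            face⊗ k i (tc p (suc q) e x y) ≡ tc p q (suc-injective (trans (sym (+-suc p q)) e)) x (B.face k j y)
  face-⊗ʳ {p = zero} refl k i j i≡j with refl ← toℕ-injective {i = i} {j = j} i≡j = refl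
  face-⊗ʳ {p = suc p} {q = q} refl k i j i≡j
    with refl ← toℕ-injective {i = i} {j = suc p ↑ʳ j} (trans i≡j (sym (toℕ-↑ʳ (suc p) j)))
    rewrite splitAt-↑ʳ (suc p) (suc q) j = tc-cong refl refl

  face-first-ˡ : ∀ {n p q} (e : suc p + q ≡ suc n) {x y} k →
                 face⊗ k zero (tc (suc p) q e x y) ≡ tc p q (suc-injective e) (A.face k zero x) y
  face-first-ˡ e k = face-⊗ˡ e k zero zero refl

  face-last-ʳ : ∀ {n p q} (e : p + suc q ≡ suc n) {x y} k →
                face⊗ k (fromℕ n) (tc p (suc q) e x y) ≡ tc p q (suc-injective (trans (sym (+-suc p q)) e)) x (B.face k (fromℕ q) y)
  face-last-ʳ {n} {p} {q} e k = face-⊗ʳ e k (fromℕ n) (fromℕ q) (begin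
    toℕ (fromℕ n)     ≡⟨ toℕ-fromℕ n ⟩
    n                 ≡⟨ suc-injective (trans (sym (+-suc p q)) e) ⟨
    p + q             ≡⟨ cong (p +_) (toℕ-fromℕ q) ⟨
    p + toℕ (fromℕ q) ∎)
    where open ≡-Reasoning

  face-last-ˡ : ∀ {n p} (e : suc p + 0 ≡ suc n) {x y} k →
                face⊗ k (fromℕ n) (tc (suc p) 0 e x y) ≡ tc p 0 (suc-injective e) (A.face k (fromℕ p) x) y
  face-last-ˡ {n} {p} e k = face-⊗ˡ e k (fromℕ n) (fromℕ p) (begin
    toℕ (fromℕ n)     ≡⟨ toℕ-fromℕ n ⟩
    n                 ≡⟨ suc-injective e ⟨
    p + 0             ≡⟨ +-identityʳ p ⟩
    p                 ≡⟨ toℕ-fromℕ p ⟨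
    toℕ (fromℕ p)     ∎)
    where open ≡-Reasoning

  module _ (isA : IsHDA A) (isB : IsHDA B) where
    open ≡-Reasoning

    -- ˡ / ʳ record whether the faces r and suc s are taken in an A- or a B-direction.
    private
      cubical-ˡˡ : ∀ {n p q} {e : suc p + q ≡ suc (suc n)} {x y} k l (r s : Fin (suc n)) (S : Fin p) →
                   toℕ s ≡ toℕ S → toℕ r ≤ toℕ s →
                   face⊗ k r (face⊗ l (suc s) (tc (suc p) q e x y)) ≡ face⊗ l s (face⊗ k (inject₁ r) (tc (suc p) q e x y))
      cubical-ˡˡ {p = suc p} {q} {e} {x} {y} k l r s S s≡S r≤s = begin
        face⊗ k r (face⊗ l (suc s) (tc (suc (suc p)) q e x y))  ≡⟨ cong (face⊗ k r) (face-⊗ˡ e l (suc s) (suc S) (cong suc s≡S)) ⟩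
        face⊗ k r (tc (suc p) q e₁ (A.face l (suc S) x) y)      ≡⟨ face-⊗ˡ e₁ k r R r≡R ⟩
        tc p q _ (A.face k R (A.face l (suc S) x)) y            ≡⟨ tc-cong (IsHDA.cubical isA k l R S x R≤S) refl ⟩
        tc p q _ (A.face l S (A.face k (inject₁ R) x)) y        ≡⟨ face-⊗ˡ e₁ l s S s≡S ⟨
        face⊗ l s (tc (suc p) q e₁ (A.face k (inject₁ R) x) y)  ≡⟨ cong (face⊗ l s) (face-⊗ˡ e k (inject₁ r) (inject₁ R) (toℕ-inject₁-cong r≡R)) ⟨
        face⊗ l s (face⊗ k (inject₁ r) (tc (suc (suc p)) q e x y)) ∎
        where
        e₁ = suc-injective e
        r≤S = subst (toℕ r ≤_) s≡S r≤s
        R = proj₁ (fin-lower r S r≤S)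
        r≡R = proj₂ (fin-lower r S r≤S)
        R≤S = subst (_≤ toℕ S) r≡R r≤S

      cubical-ˡʳ : ∀ {n p q} {e : p + q ≡ suc (suc n)} {x y} k l (r s : Fin (suc n)) (R : Fin p) (S : Fin q) →
                   toℕ r ≡ toℕ R → suc (toℕ s) ≡ p + toℕ S →
                   face⊗ k r (face⊗ l (suc s) (tc p q e x y)) ≡ face⊗ l s (face⊗ k (inject₁ r) (tc p q e x y))
      cubical-ˡʳ {p = suc p} {suc q} {e} {x} {y} k l r s R S r≡R s≡p+S = begin
        face⊗ k r (face⊗ l (suc s) (tc (suc p) (suc q) e x y))  ≡⟨ cong (face⊗ k r) (face-⊗ʳ e l (suc s) S s≡p+S) ⟩
        face⊗ k r (tc (suc p) q eʳ x (B.face l S y))             ≡⟨ face-⊗ˡ eʳ k r R r≡R ⟩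
        tc p q _ (A.face k R x) (B.face l S y)                   ≡⟨ tc-cong refl refl ⟩
        tc p q _ (A.face k R x) (B.face l S y)                   ≡⟨ face-⊗ʳ eˡ l s S (suc-injective s≡p+S) ⟨
        face⊗ l s (tc p (suc q) eˡ (A.face k R x) y)             ≡⟨ cong (face⊗ l s) (face-⊗ˡ e k (inject₁ r) R (trans (toℕ-inject₁ r) r≡R)) ⟨
        face⊗ l s (face⊗ k (inject₁ r) (tc (suc p) (suc q) e x y)) ∎
        where
        eʳ = suc-injective (trans (sym (+-suc (suc p) q)) e)
        eˡ = suc-injective e

      cubical-ʳʳ : ∀ {n p q} {e : p + q ≡ suc (suc n)} {x y} k l (r s : Fin (suc n)) (R S : Fin q) →
                   toℕ r ≡ p + toℕ R → suc (toℕ s) ≡ p + toℕ S → toℕ r ≤ toℕ s →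
                   face⊗ k r (face⊗ l (suc s) (tc p q e x y)) ≡ face⊗ l s (face⊗ k (inject₁ r) (tc p q e x y))
      cubical-ʳʳ {p = p} k l r s R zero r≡p+R s≡p+0 r≤s =
        ⊥-elim (1+n≰n (≤-trans (≤-reflexive (trans s≡p+0 (+-identityʳ p)))
                                (≤-trans (m≤m+n p _) (subst (_≤ toℕ s) r≡p+R r≤s))))
      cubical-ʳʳ {p = p} {suc (suc m)} {e} {x} {y} k l r s R (suc S) r≡p+R s≡p+S r≤s = begin
        face⊗ k r (face⊗ l (suc s) (tc p (suc (suc m)) e x y))  ≡⟨ cong (face⊗ k r) (face-⊗ʳ e l (suc s) (suc S) s≡p+S) ⟩
        face⊗ k r (tc p (suc m) e₁ x (B.face l (suc S) y))      ≡⟨ face-⊗ʳ e₁ k r R' (trans r≡p+R (cong (p +_) R≡R')) ⟩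
        tc p m e₂ x (B.face k R' (B.face l (suc S) y))          ≡⟨ tc-cong refl (IsHDA.cubical isB k l R' S y R'≤S) ⟩
        tc p m e₂ x (B.face l S (B.face k (inject₁ R') y))      ≡⟨ face-⊗ʳ e₁ l s S s≡p+S' ⟨
        face⊗ l s (tc p (suc m) e₁ x (B.face k (inject₁ R') y)) ≡⟨ cong (face⊗ l s) (face-⊗ʳ e k (inject₁ r) (inject₁ R') r'≡p+R') ⟨
        face⊗ l s (face⊗ k (inject₁ r) (tc p (suc (suc m)) e x y)) ∎
        where
        e₁ = suc-injective (trans (sym (+-suc p (suc m))) e)
        e₂ = suc-injective (trans (sym (+-suc p m)) e₁)
        s≡p+S' : toℕ s ≡ p + toℕ S
        s≡p+S' = suc-injective (trans s≡p+S (+-suc p (toℕ S)))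
        R≤S : toℕ R ≤ toℕ S
        R≤S = +-cancelˡ-≤ p _ _ (subst₂ _≤_ r≡p+R s≡p+S' r≤s)
        R' = proj₁ (fin-lower R S R≤S)
        R≡R' = proj₂ (fin-lower R S R≤S)
        R'≤S = subst (_≤ toℕ S) R≡R' R≤S
        r'≡p+R' : toℕ (inject₁ r) ≡ p + toℕ (inject₁ R')
        r'≡p+R' = trans (toℕ-inject₁ r) (trans r≡p+R (cong (p +_) (trans R≡R' (sym (toℕ-inject₁ R')))))

    cubical-⊗ : ∀ {n} k l (r s : Fin (suc n)) (c : TC (suc (suc n))) → toℕ r ≤ toℕ s →
                face⊗ k r (face⊗ l (suc s) c) ≡ face⊗ l s (face⊗ k (inject₁ r) c)
    cubical-⊗ k l r s (tc p q e x y) r≤s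
      with split-< p q (suc (toℕ s)) (subst (suc (toℕ s) <_) (sym e) (s≤s (toℕ<n s)))
    ... | inj₁ (suc S , s≡S) = cubical-ˡˡ {e = e} {x} {y} k l r s S (suc-injective s≡S) r≤s
    ... | inj₂ (S , s≡p+S) with split-< p q (toℕ r) (subst (toℕ r <_) (sym e) (<-trans (toℕ<n r) (n<1+n _)))
    ...   | inj₁ (R , r≡R)   = cubical-ˡʳ {e = e} {x} {y} k l r s R S r≡R s≡p+S
    ...   | inj₂ (R , r≡p+R) = cubical-ʳʳ {e = e} {x} {y} k l r s R S r≡p+R s≡p+S r≤s

  lab-coh-⊗ : IsHDA A → IsHDA B → ∀ i (c : TC 2) → lab⊗ (face⊗ false i c) ≡ lab⊗ (face⊗ true i c)
  lab-coh-⊗ isA isB i          (tc 0 2 refl x y) = cong inj₂ (IsHDA.lab-coh isB i y)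
  lab-coh-⊗ isA isB zero       (tc 1 1 refl x y) = refl
  lab-coh-⊗ isA isB (suc zero) (tc 1 1 refl x y) = refl
  lab-coh-⊗ isA isB zero       (tc 2 0 refl x y) = cong inj₁ (IsHDA.lab-coh isA zero x)
  lab-coh-⊗ isA isB (suc zero) (tc 2 0 refl x y) = cong inj₁ (IsHDA.lab-coh isA (suc zero) x)

  isHDA-⊗ : IsHDA A → IsHDA B → IsHDA (A ⊗ B)
  isHDA-⊗ isA isB = record { cubical = cubical-⊗ isA isB ; lab-coh = lab-coh-⊗ isA isB }

  SameFaces : ∀ {m} → TC (suc m) → TC (suc m) → Set
  SameFaces c c' = ∀ k i → face⊗ k i c ≡ face⊗ k i c'

  last-face-p≢0 : ∀ {m p q} (e : suc p + q ≡ suc (suc m)) {x y} →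
                  TCube.p (face⊗ false (fromℕ (suc m)) (tc (suc p) q e x y)) ≢ 0
  last-face-p≢0 {q = zero}  e p≡0 =
    0≢1+n (trans (sym (cong (_+ 0) (trans (sym (cong TCube.p (face-last-ˡ e false))) p≡0))) (suc-injective e))
  last-face-p≢0 {p = p} {suc q} e p≡0 with () ← trans (sym (cong TCube.p (face-last-ʳ {p = suc p} e false))) p≡0

  sameFaces⇒p≡ : ∀ {m} (c c' : TC (suc (suc m))) → SameFaces c c' → TCube.p c ≡ TCube.p c'
  sameFaces⇒p≡ (tc zero q e x y) (tc zero q' e' x' y') same = refl
  sameFaces⇒p≡ (tc (suc p) q e x y) (tc (suc p') q' e' x' y') same =
    cong suc (tc-injective-p (trans (sym (face-first-ˡ e false)) (trans (same false zero) (face-first-ˡ e' false))))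
  sameFaces⇒p≡ {m} (tc zero q refl x y) (tc (suc p') q' e' x' y') same =
    ⊥-elim (last-face-p≢0 {p = p'} {q'} e' {x'} {y'} (sym (cong TCube.p (same false (fromℕ (suc m))))))
  sameFaces⇒p≡ {m} (tc (suc p) q e x y) (tc zero q' refl x' y') same =
    ⊥-elim (last-face-p≢0 {p = p} {q} e {x} {y} (cong TCube.p (same false (fromℕ (suc m)))))

  sameFaces⇒x≡ : HM3 A → ∀ {m p q} (e e' : p + q ≡ suc (suc m)) {x x' y y'} →
                 SameFaces (tc p q e x y) (tc p q e' x' y') → x ≡ x'
  sameFaces⇒x≡ hA {m} {q = suc q} e e' same =
    tc-injective-x (trans (sym (face-last-ʳ e false)) (trans (same false (fromℕ (suc m))) (face-last-ʳ e' false)))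
  sameFaces⇒x≡ hA {m} {p} {zero} e e' {x} {x'} same with refl ← trans (sym (+-identityʳ p)) e =
    hA m x x' λ k r → tc-injective-x (trans (sym (face-⊗ˡ e k r r refl)) (trans (same k r) (face-⊗ˡ e' k r r refl)))

  sameFaces⇒y≡ : HM3 B → ∀ {m p q} (e e' : p + q ≡ suc (suc m)) {x x' y y'} →
                 SameFaces (tc p q e x y) (tc p q e' x' y') → y ≡ y'
  sameFaces⇒y≡ hB {p = suc p} e e' same =
    tc-injective-y (trans (sym (face-first-ˡ e false)) (trans (same false zero) (face-first-ˡ e' false)))
  sameFaces⇒y≡ hB {m} {zero} refl e' {y = y} {y'} same =
    hB m y y' λ k r → tc-injective-y (trans (sym (face-⊗ʳ refl k r r refl)) (trans (same k r) (face-⊗ʳ e' k r r refl)))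

  hm3-⊗ : HM3 A → HM3 B → HM3 (A ⊗ B)
  hm3-⊗ hA hB m c@(tc p q e x y) c'@(tc p' q' e' x' y') same
    with refl ← sameFaces⇒p≡ c c' same
    with refl ← +-cancelˡ-≡ p q q' (trans e (sym e'))
    = tc-cong (sameFaces⇒x≡ hA e e' same) (sameFaces⇒y≡ hB e e' same)

  cubes₀-↔ : TC 0 ↔ (A.Cube 0 × B.Cube 0)
  cubes₀-↔ = mk↔ₛ′ (λ { (tc zero zero refl x y) → x , y }) (λ (x , y) → tc 0 0 refl x y)
                    (λ _ → refl) (λ { (tc zero zero refl x y) → refl })

  cubes₁-↔ : TC 1 ↔ ((A.Cube 1 × B.Cube 0) ⊎ (A.Cube 0 × B.Cube 1))
  cubes₁-↔ = mk↔ₛ′ to from (λ { (inj₁ _) → refl ; (inj₂ _) → refl }) from∘to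
    where
    to : TC 1 → (A.Cube 1 × B.Cube 0) ⊎ (A.Cube 0 × B.Cube 1)
    to (tc 1 0 refl a w) = inj₁ (a , w)
    to (tc 0 1 refl v b) = inj₂ (v , b)
    from : (A.Cube 1 × B.Cube 0) ⊎ (A.Cube 0 × B.Cube 1) → TC 1
    from (inj₁ (a , w)) = tc 1 0 refl a w
    from (inj₂ (v , b)) = tc 0 1 refl v b
    from∘to : ∀ c → from (to c) ≡ c
    from∘to (tc 1 0 refl a w) = refl
    from∘to (tc 0 1 refl v b) = refl

  Pureˡ : ∀ {m} → B.Cube 0 → TC m → Set
  Pureˡ {m} w c = Σ (A.Cube m) λ a → c ≡ tc m 0 (+-identityʳ m) a w

  Pureʳ : ∀ {m} → A.Cube 0 → TC m → Set
  Pureʳ {m} v c = Σ (B.Cube m) λ b → c ≡ tc 0 m refl v b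

  Pureˡ-face : ∀ {m w} {c : TC (suc m)} k i → Pureˡ w c → Pureˡ w (face⊗ k i c)
  Pureˡ-face {m} k i (a , refl) = A.face k i a , trans (face-⊗ˡ (+-identityʳ (suc m)) k i i refl) (tc-cong refl refl)

  Pureʳ-face : ∀ {m v} {c : TC (suc m)} k i → Pureʳ v c → Pureʳ v (face⊗ k i c)
  Pureʳ-face k i (b , refl) = B.face k i b , refl

  Pureˡ-by-first-face : ∀ {m w} (c : TC (suc (suc m))) → Pureˡ w (face⊗ false zero c) → Pureˡ w c
  Pureˡ-by-first-face (tc zero q refl x y) (_ , eq) with () ← tc-injective-p eq
  Pureˡ-by-first-face (tc (suc p) q e x y) (a , eq)
    with first≡ ← trans (sym (face-first-ˡ {p = p} e false)) eq
    with refl ← tc-injective-p first≡ | refl ← tc-injective-q first≡ = x , tc-cong refl (tc-injective-y first≡)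

  Pureʳ-by-last-face : ∀ {m v} (c : TC (suc (suc m))) → Pureʳ v (face⊗ false (fromℕ (suc m)) c) → Pureʳ v c
  Pureʳ-by-last-face (tc (suc p) zero e x y) (_ , eq) with () ← tc-injective-q (trans (sym (face-last-ˡ {p = p} e false)) eq)
  Pureʳ-by-last-face (tc p (suc q) e x y) (b , eq)
    with last≡ ← trans (sym (face-last-ʳ {p = p} e false)) eq
    with refl ← tc-injective-p last≡ | refl ← tc-injective-q last≡ = y , tc-cong (tc-injective-x last≡) refl

  module _ {n : ℕ} (g : Shell (A ⊗ B) (suc n)) (shell : IsShell (A ⊗ B) g) where

    Pureˡ-at-suc : ∀ {w} → Pureˡ w (g false zero) → ∀ k j → Pureˡ w (g k (suc j))
    Pureˡ-at-suc {w} γ₀ k j =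
      Pureˡ-by-first-face (g k (suc j)) (subst (Pureˡ w) (sym (shell false k zero j z≤n)) (Pureˡ-face k j γ₀))

    Pureˡ-shell : ∀ {w} → Pureˡ w (g false zero) → ∀ k i → Pureˡ w (g k i)
    Pureˡ-shell {w} γ₀ k zero    = Pureˡ-by-first-face (g k zero)
      (subst (Pureˡ w) (shell k false zero zero z≤n) (Pureˡ-face k zero (Pureˡ-at-suc γ₀ false zero)))
    Pureˡ-shell     γ₀ k (suc j) = Pureˡ-at-suc γ₀ k j

    Pureʳ-at-inject₁ : ∀ {v} → Pureʳ v (g false (fromℕ (suc (suc n)))) → ∀ k j → Pureʳ v (g k (inject₁ j))
    Pureʳ-at-inject₁ {v} γₗ k j = Pureʳ-by-last-face (g k (inject₁ j))
      (subst (Pureʳ v) (shell k false j (fromℕ (suc n)) (≤fromℕ j)) (Pureʳ-face k j γₗ))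

    Pureʳ-shell : ∀ {v} → Pureʳ v (g false (fromℕ (suc (suc n)))) → ∀ k i → Pureʳ v (g k i)
    Pureʳ-shell {v} γₗ k i with view i
    ... | ‵inject₁ j = Pureʳ-at-inject₁ γₗ k j
    ... | ‵fromℕ     = Pureʳ-by-last-face (g k (fromℕ (suc (suc n))))
      (subst (Pureʳ v) (sym (shell false k (fromℕ (suc n)) (fromℕ (suc n)) ≤-refl))
        (Pureʳ-face k (fromℕ (suc n)) (Pureʳ-at-inject₁ γₗ false (fromℕ (suc n)))))

  Mixed : ∀ {m} → TC m → Set
  Mixed {m} c = Σ ℕ λ p → Σ ℕ λ q → Σ (suc p + suc q ≡ m) λ e →
                Σ (A.Cube (suc p)) λ a → Σ (B.Cube (suc q)) λ b → c ≡ tc (suc p) (suc q) e a b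

  mixed-determined : ∀ {n} {c c' : TC (suc n)} → Mixed c →
                     face⊗ false zero c ≡ face⊗ false zero c' →
                     face⊗ false (fromℕ n) c ≡ face⊗ false (fromℕ n) c' → c ≡ c'
  mixed-determined {c' = tc zero q' refl x' y'} (p , q , e , a , b , refl) _ last≡
    with () ← tc-injective-p (trans (sym (face-last-ʳ {p = suc p} e false)) last≡)
  mixed-determined {c' = tc (suc p') q' e' x' y'} (p , q , e , a , b , refl) first≡ last≡
    with first≡′ ← trans (sym (face-first-ˡ {p = p} e false)) (trans first≡ (face-first-ˡ {p = p'} e' false))
    with refl ← tc-injective-p first≡′ | refl ← tc-injective-q first≡′
    = tc-cong (tc-injective-x (trans (sym (face-last-ʳ {p = suc p} e false)) (trans last≡ (face-last-ʳ {p = suc p} e' false))))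
              (tc-injective-y first≡′)

  private
    mixed-faceˡ : ∀ {n p q} (e : suc p + suc q ≡ suc (suc n)) {a b} k (i : Fin (suc (suc n))) (j : Fin (suc p)) →
                  toℕ i ≡ toℕ j → (toℕ i ≡ 0 → 0 < p) → Mixed (face⊗ k i (tc (suc p) (suc q) e a b))
    mixed-faceˡ {p = zero}          e k i zero i≡0 first⇒p>0 = ⊥-elim (<-irrefl refl (first⇒p>0 i≡0))
    mixed-faceˡ {p = suc p} {q} e {a} {b} k i j i≡j _ = p , q , suc-injective e , A.face k j a , b , face-⊗ˡ e k i j i≡j

    mixed-faceʳ : ∀ {n p q} (e : suc p + suc q ≡ suc (suc n)) {a b} k (i : Fin (suc (suc n))) (j : Fin (suc q)) →
                  toℕ i ≡ suc p + toℕ j → (toℕ i ≡ suc n → 0 < q) → Mixed (face⊗ k i (tc (suc p) (suc q) e a b))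
    mixed-faceʳ {p = p} {zero} e k i zero i≡p last⇒q>0 =
      ⊥-elim (<-irrefl refl (last⇒q>0 (trans i≡p (suc-injective (trans (sym (+-suc (suc p) 0)) e)))))
    mixed-faceʳ {p = p} {suc q} e {a} {b} k i j i≡p+j _ =
      p , q , _ , a , B.face k j b , face-⊗ʳ e k i j i≡p+j

  mixed-face : ∀ {n p q} (e : suc p + suc q ≡ suc (suc n)) {a b} k (i : Fin (suc (suc n))) →
               (toℕ i ≡ 0 → 0 < p) → (toℕ i ≡ suc n → 0 < q) → Mixed (face⊗ k i (tc (suc p) (suc q) e a b))
  mixed-face {p = p} {q} e k i first⇒p>0 last⇒q>0
    with split-< (suc p) (suc q) (toℕ i) (subst (toℕ i <_) (sym e) (toℕ<n i))
  ... | inj₁ (j , i≡j)   = mixed-faceˡ e k i j i≡j first⇒p>0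
  ... | inj₂ (j , i≡p+j) = mixed-faceʳ e k i j i≡p+j last⇒q>0

  data ShellKind {n} (γ₀ γₗ : TC (suc (suc n))) : Set where
    pureˡ : ∀ w → Pureˡ w γ₀ → ShellKind γ₀ γₗ
    pureʳ : ∀ v → Pureʳ v γₗ → ShellKind γ₀ γₗ
    mixed : ∀ {p q} (e : suc p + suc q ≡ suc (suc (suc n))) a b →
            face⊗ false zero (tc (suc p) (suc q) e a b) ≡ γ₀ →
            face⊗ false (fromℕ (suc (suc n))) (tc (suc p) (suc q) e a b) ≡ γₗ → ShellKind γ₀ γₗ

  shell-kind : ∀ {n} (γ₀ γₗ : TC (suc (suc n))) → face⊗ false zero γₗ ≡ face⊗ false (fromℕ (suc n)) γ₀ → ShellKind γ₀ γₗ
  shell-kind (tc p zero e a w) γₗ _ with refl ← trans (sym (+-identityʳ p)) e = pureˡ w (a , tc-cong refl refl)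
  shell-kind (tc p (suc q) e a b) (tc zero q' refl v b') _ = pureʳ v (b' , refl)
  shell-kind (tc p (suc q) e a b) (tc (suc p') q' e' a' b') corner
    with corner′ ← trans (sym (face-first-ˡ {p = p'} e' false)) (trans corner (face-last-ʳ {p = p} e false))
    with refl ← tc-injective-p corner′ | refl ← tc-injective-q corner′
    = mixed (cong suc e) a' b
        (trans (face-first-ˡ (cong suc e) false) (tc-cong (tc-injective-x corner′) refl))
        (trans (face-last-ʳ {p = suc p} (cong suc e) false) (tc-cong refl (sym (tc-injective-y corner′))))

module TensorOfModels (S T : LTS) (A : RawHDA (LTS.Lab S)) (B : RawHDA (LTS.Lab T))
                   (hA : IsHDAModel S A) (hB : IsHDAModel T B) where
  open Tensor A B
  private
    module A = RawHDA A
    module B = RawHDA B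
    module hA = IsHDAModel hA
    module hB = IsHDAModel hB

  hm1-⊗ : HM1 (S ||| T) (A ⊗ B)
  hm1-⊗ = record
    { iso       = iso
    ; iso-face  = iso-face
    ; iso-init  = cong₂ _,_ (HDAIso.iso-init hA.hm1) (HDAIso.iso-init hB.hm1)
    ; iso-final = λ { (tc zero zero refl x y) → HDAIso.iso-final hA.hm1 x ×-⇔ HDAIso.iso-final hB.hm1 y }
    ; iso-lab   = λ { (tc 1 0 refl a w) → cong inj₁ (HDAIso.iso-lab hA.hm1 a)
                    ; (tc 0 1 refl v b) → cong inj₂ (HDAIso.iso-lab hB.hm1 b) } }
    where
    isoA = HDAIso.iso hA.hm1
    isoB = HDAIso.iso hB.hm1
    iso : ∀ m → RawHDA.Cube (trunc1 (A ⊗ B)) m ↔ RawHDA.Cube (U (S ||| T)) m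
    iso zero          = ↔-trans cubes₀-↔ (isoA 0 ×-↔ isoB 0)
    iso (suc zero)    = ↔-trans cubes₁-↔ ((isoA 1 ×-↔ isoB 0) ⊎-↔ (isoA 0 ×-↔ isoB 1))
    iso (suc (suc m)) = mk↔ₛ′ (λ ()) (λ ()) (λ ()) (λ ())
    iso-face : ∀ {m} k i (x : RawHDA.Cube (trunc1 (A ⊗ B)) (suc m)) →
               Inverse.to (iso m) (RawHDA.face (trunc1 (A ⊗ B)) {m} k i x)
                 ≡ RawHDA.face (U (S ||| T)) {m} k i (Inverse.to (iso (suc m)) x)
    iso-face {zero} false zero (tc 1 0 refl a w) = cong (_, _) (HDAIso.iso-face hA.hm1 false zero a)
    iso-face {zero} true  zero (tc 1 0 refl a w) = cong (_, _) (HDAIso.iso-face hA.hm1 true zero a)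
    iso-face {zero} false zero (tc 0 1 refl v b) = cong (_ ,_) (HDAIso.iso-face hB.hm1 false zero b)
    iso-face {zero} true  zero (tc 0 1 refl v b) = cong (_ ,_) (HDAIso.iso-face hB.hm1 true zero b)

  hm2-⊗ : HM2 (S ||| T) (A ⊗ B)
  hm2-⊗ (tc 0 2 refl x y) = hB.hm2 y
  hm2-⊗ (tc 1 1 refl x y) = tt
  hm2-⊗ (tc 2 0 refl x y) = hA.hm2 x

  pureˡ-fillable : ∀ {n} (g : Shell (A ⊗ B) n) → IsShell (A ⊗ B) g → ∀ w (pure : ∀ k i → Pureˡ w (g k i)) →
                   WellLabelled S A (λ k i → proj₁ (pure k i)) → ¬ ¬ Filler (A ⊗ B) g
  pureˡ-fillable {n} g shell w pure wl = ¬¬-map lift (model⇒fillsShells hA f f-shell wl)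
    where
    open ≡-Reasoning
    e = +-identityʳ (suc n)
    f : Shell A n
    f k i = proj₁ (pure k i)
    g≡ : ∀ k i → g k i ≡ tc (suc n) 0 e (f k i) w
    g≡ k i = proj₂ (pure k i)
    f-shell : IsShell A f
    f-shell k l r s r≤s = tc-injective-x (begin
      tc n 0 _ (A.face k r (f l (suc s))) w          ≡⟨ face-⊗ˡ e k r r refl ⟨
      face⊗ k r (tc (suc n) 0 e (f l (suc s)) w)     ≡⟨ cong (face⊗ k r) (g≡ l (suc s)) ⟨
      face⊗ k r (g l (suc s))                        ≡⟨ shell k l r s r≤s ⟩
      face⊗ l s (g k (inject₁ r))                    ≡⟨ cong (face⊗ l s) (g≡ k (inject₁ r)) ⟩
      face⊗ l s (tc (suc n) 0 e (f k (inject₁ r)) w) ≡⟨ face-⊗ˡ e l s s refl ⟩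
      tc n 0 _ (A.face l s (f k (inject₁ r))) w      ∎)
    lift : Filler A f → Filler (A ⊗ B) g
    lift (a , a-fills) = tc (suc (suc n)) 0 (+-identityʳ _) a w , λ k i → begin
      face⊗ k i (tc (suc (suc n)) 0 (+-identityʳ _) a w) ≡⟨ face-⊗ˡ (+-identityʳ _) k i i refl ⟩
      tc (suc n) 0 _ (A.face k i a) w                     ≡⟨ tc-cong (a-fills k i) refl ⟩
      tc (suc n) 0 e (f k i) w                            ≡⟨ g≡ k i ⟨
      g k i                                               ∎

  pureʳ-fillable : ∀ {n} (g : Shell (A ⊗ B) n) → IsShell (A ⊗ B) g → ∀ v (pure : ∀ k i → Pureʳ v (g k i)) →
                   WellLabelled T B (λ k i → proj₁ (pure k i)) → ¬ ¬ Filler (A ⊗ B) g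
  pureʳ-fillable {n} g shell v pure wl = ¬¬-map lift (model⇒fillsShells hB f f-shell wl)
    where
    open ≡-Reasoning
    f : Shell B n
    f k i = proj₁ (pure k i)
    g≡ : ∀ k i → g k i ≡ tc 0 (suc n) refl v (f k i)
    g≡ k i = proj₂ (pure k i)
    f-shell : IsShell B f
    f-shell k l r s r≤s = tc-injective-y (begin
      tc 0 n refl v (B.face k r (f l (suc s)))        ≡⟨ cong (face⊗ k r) (g≡ l (suc s)) ⟨
      face⊗ k r (g l (suc s))                         ≡⟨ shell k l r s r≤s ⟩
      face⊗ l s (g k (inject₁ r))                     ≡⟨ cong (face⊗ l s) (g≡ k (inject₁ r)) ⟩
      tc 0 n refl v (B.face l s (f k (inject₁ r)))    ∎)
    lift : Filler B f → Filler (A ⊗ B) g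
    lift (b , b-fills) = tc 0 (suc (suc n)) refl v b , λ k i →
      trans (cong (tc 0 (suc n) refl v) (b-fills k i)) (sym (g≡ k i))

  SquareFillable : (c₀₀ c₀₁ c₁₀ c₁₁ : TC 1) → Set
  SquareFillable c₀₀ c₀₁ c₁₀ c₁₁ =
    IsShell (A ⊗ B) g → WellLabelled (S ||| T) (A ⊗ B) g → ¬ ¬ Filler (A ⊗ B) g
    where g = square (A ⊗ B) c₀₀ c₀₁ c₁₀ c₁₁

  pureˡ-square-fillable : ∀ a₀ w₀ a₁ w₁ a₂ w₂ a₃ w₃ →
                          SquareFillable (tc 1 0 refl a₀ w₀) (tc 1 0 refl a₁ w₁) (tc 1 0 refl a₂ w₂) (tc 1 0 refl a₃ w₃)
  pureˡ-square-fillable a₀ w₀ a₁ w₁ a₂ w₂ a₃ w₃ shell (lab-coh , ⋉) =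
    pureˡ-fillable g shell w₀ (λ k i → square A a₀ a₁ a₂ a₃ k i , g≡ k i) (lab-coh-A , ⋉)
    where
    g : Shell (A ⊗ B) 0
    g = square (A ⊗ B) (tc 1 0 refl a₀ w₀) (tc 1 0 refl a₁ w₁) (tc 1 0 refl a₂ w₂) (tc 1 0 refl a₃ w₃)
    corner : ∀ k l → face⊗ k zero (g l (suc zero)) ≡ face⊗ l zero (g k zero)
    corner = square-corner (A ⊗ B) g shell
    g≡ : ∀ k i → g k i ≡ tc 1 0 (+-identityʳ 1) (square A a₀ a₁ a₂ a₃ k i) w₀
    g≡ false zero       = refl
    g≡ false (suc zero) = tc-cong refl (tc-injective-y (corner false false))
    g≡ true  zero       = tc-cong refl (trans (sym (tc-injective-y (corner true false))) (tc-injective-y (corner false false)))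
    g≡ true  (suc zero) = tc-cong refl (tc-injective-y (corner false true))
    lab-coh-A : ∀ i → A.lab (square A a₀ a₁ a₂ a₃ false i) ≡ A.lab (square A a₀ a₁ a₂ a₃ true i)
    lab-coh-A zero       = inj₁-injective (lab-coh zero)
    lab-coh-A (suc zero) = inj₁-injective (lab-coh (suc zero))

  pureʳ-square-fillable : ∀ v₀ b₀ v₁ b₁ v₂ b₂ v₃ b₃ →
                          SquareFillable (tc 0 1 refl v₀ b₀) (tc 0 1 refl v₁ b₁) (tc 0 1 refl v₂ b₂) (tc 0 1 refl v₃ b₃)
  pureʳ-square-fillable v₀ b₀ v₁ b₁ v₂ b₂ v₃ b₃ shell (lab-coh , ⋉) =
    pureʳ-fillable g shell v₀ (λ k i → square B b₀ b₁ b₂ b₃ k i , g≡ k i) (lab-coh-B , ⋉)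
    where
    g : Shell (A ⊗ B) 0
    g = square (A ⊗ B) (tc 0 1 refl v₀ b₀) (tc 0 1 refl v₁ b₁) (tc 0 1 refl v₂ b₂) (tc 0 1 refl v₃ b₃)
    corner : ∀ k l → face⊗ k zero (g l (suc zero)) ≡ face⊗ l zero (g k zero)
    corner = square-corner (A ⊗ B) g shell
    g≡ : ∀ k i → g k i ≡ tc 0 1 refl v₀ (square B b₀ b₁ b₂ b₃ k i)
    g≡ false zero       = refl
    g≡ false (suc zero) = tc-cong (tc-injective-x (corner false false)) refl
    g≡ true  zero       = tc-cong (trans (sym (tc-injective-x (corner true false))) (tc-injective-x (corner false false))) refl
    g≡ true  (suc zero) = tc-cong (tc-injective-x (corner false true)) refl
    lab-coh-B : ∀ i → B.lab (square B b₀ b₁ b₂ b₃ false i) ≡ B.lab (square B b₀ b₁ b₂ b₃ true i)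
    lab-coh-B zero       = inj₂-injective (lab-coh zero)
    lab-coh-B (suc zero) = inj₂-injective (lab-coh (suc zero))

  mixed-square-fillable : ∀ v₀ b₀ a₁ w₁ v₂ b₂ a₃ w₃ →
                          SquareFillable (tc 0 1 refl v₀ b₀) (tc 1 0 refl a₁ w₁) (tc 0 1 refl v₂ b₂) (tc 1 0 refl a₃ w₃)
  mixed-square-fillable v₀ b₀ a₁ w₁ v₂ b₂ a₃ w₃ shell (lab-coh , _) ¬fill = ¬fill (tc 1 1 refl a₁ b₀ , fills)
    where
    g : Shell (A ⊗ B) 0
    g = square (A ⊗ B) (tc 0 1 refl v₀ b₀) (tc 1 0 refl a₁ w₁) (tc 0 1 refl v₂ b₂) (tc 1 0 refl a₃ w₃)
    corner : ∀ k l → face⊗ k zero (g l (suc zero)) ≡ face⊗ l zero (g k zero)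
    corner = square-corner (A ⊗ B) g shell
    b₀≡b₂ : b₀ ≡ b₂
    b₀≡b₂ = hm1⇒edge-unique hB.hm1 b₀ b₂
      (trans (sym (tc-injective-y (corner false false))) (tc-injective-y (corner true false)))
      (trans (sym (tc-injective-y (corner false true))) (tc-injective-y (corner true true)))
      (inj₂-injective (lab-coh zero))
    a₁≡a₃ : a₁ ≡ a₃
    a₁≡a₃ = hm1⇒edge-unique hA.hm1 a₁ a₃
      (trans (tc-injective-x (corner false false)) (sym (tc-injective-x (corner false true))))
      (trans (tc-injective-x (corner true false)) (sym (tc-injective-x (corner true true))))
      (inj₁-injective (lab-coh (suc zero)))
    fills : ∀ k i → face⊗ k i (tc 1 1 refl a₁ b₀) ≡ g k i
    fills false zero       = tc-cong (tc-injective-x (corner false false)) refl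
    fills false (suc zero) = tc-cong refl (sym (tc-injective-y (corner false false)))
    fills true  zero       = tc-cong (tc-injective-x (corner true false)) b₀≡b₂
    fills true  (suc zero) = tc-cong a₁≡a₃ (sym (tc-injective-y (corner false true)))

  square-fillable : ∀ c₀₀ c₀₁ c₁₀ c₁₁ → SquareFillable c₀₀ c₀₁ c₁₀ c₁₁
  square-fillable (tc 1 0 refl a₀ w₀) (tc 1 0 refl a₁ w₁) (tc 1 0 refl a₂ w₂) (tc 1 0 refl a₃ w₃) =
    pureˡ-square-fillable a₀ w₀ a₁ w₁ a₂ w₂ a₃ w₃
  square-fillable (tc 0 1 refl v₀ b₀) (tc 0 1 refl v₁ b₁) (tc 0 1 refl v₂ b₂) (tc 0 1 refl v₃ b₃) =
    pureʳ-square-fillable v₀ b₀ v₁ b₁ v₂ b₂ v₃ b₃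
  square-fillable (tc 0 1 refl v₀ b₀) (tc 1 0 refl a₁ w₁) (tc 0 1 refl v₂ b₂) (tc 1 0 refl a₃ w₃) =
    mixed-square-fillable v₀ b₀ a₁ w₁ v₂ b₂ a₃ w₃
  -- ⋉ of S ||| T never relates the label of a T-edge to that of an S-edge.
  square-fillable (tc 1 0 refl _ _) (tc 0 1 refl _ _) _ _ _ (_ , ())
  square-fillable (tc 1 0 refl _ _) _ (tc 0 1 refl _ _) _ _ (lab-coh , _) with () ← lab-coh zero
  square-fillable (tc 0 1 refl _ _) _ (tc 1 0 refl _ _) _ _ (lab-coh , _) with () ← lab-coh zero
  square-fillable _ (tc 1 0 refl _ _) _ (tc 0 1 refl _ _) _ (lab-coh , _) with () ← lab-coh (suc zero)
  square-fillable _ (tc 0 1 refl _ _) _ (tc 1 0 refl _ _) _ (lab-coh , _) with () ← lab-coh (suc zero)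

  -- The middle faces of α are mixed, so their end faces, transferred by the shell identities
  -- from first and last, determine them.  The face (true , zero) is mixed when p > 0;
  -- otherwise q > 0, every other face already agrees, and HM3 applies (dually at the top).
  module MixedFiller {n} (g : Shell (A ⊗ B) (suc n)) (shell : IsShell (A ⊗ B) g)
                     {p q} (e : suc p + suc q ≡ suc (suc (suc n))) (a : A.Cube (suc p)) (b : B.Cube (suc q))
                     (first : face⊗ false zero (tc (suc p) (suc q) e a b) ≡ g false zero)
                     (last : face⊗ false (fromℕ (suc (suc n))) (tc (suc p) (suc q) e a b) ≡ g false (fromℕ (suc (suc n))))
                     where
    α : TC (suc (suc (suc n)))
    α = tc (suc p) (suc q) e a b
    ∂α : Shell (A ⊗ B) (suc n)
    ∂α k i = face⊗ k i α
    ∂α-shell : IsShell (A ⊗ B) ∂α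
    ∂α-shell k l r s = cubical-⊗ hA.isHDA hB.isHDA k l r s α
    Agrees : Bool → Fin (suc (suc (suc n))) → Set
    Agrees k i = ∂α k i ≡ g k i
    last′ : Fin (suc (suc n))
    last′ = fromℕ (suc n)

    below : ∀ k l r s → toℕ r ≤ toℕ s → Agrees k (inject₁ r) → face⊗ k r (∂α l (suc s)) ≡ face⊗ k r (g l (suc s))
    below = agree-at-inject₁⇒faces-agree {D = A ⊗ B} {g = ∂α} {h = g} ∂α-shell shell
    above : ∀ k l r s → toℕ r ≤ toℕ s → Agrees l (suc s) → face⊗ l s (∂α k (inject₁ r)) ≡ face⊗ l s (g k (inject₁ r))
    above = agree-at-suc⇒faces-agree {D = A ⊗ B} {g = ∂α} {h = g} ∂α-shell shell

    middle : ∀ k (j : Fin (suc n)) → Agrees k (suc (inject₁ j))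
    middle k j = mixed-determined (mixed-face e k (suc (inject₁ j)) (λ ()) not-last)
                   (below false k zero (inject₁ j) z≤n first)
                   (above k false (suc j) last′ (≤fromℕ (suc j)) last)
      where
      not-last : toℕ (suc (inject₁ j)) ≡ suc (suc n) → 0 < q
      not-last j≡ = ⊥-elim (<-irrefl (trans (sym (toℕ-inject₁ j)) (suc-injective j≡)) (toℕ<n j))

    first-if-p>0 : 0 < p → Agrees true zero
    first-if-p>0 p>0 = mixed-determined (mixed-face e true zero (λ _ → p>0) (λ ()))
                         (above true false zero zero z≤n (middle false zero))
                         (above true false zero last′ z≤n last)

    last-if-q>0 : 0 < q → Agrees true (fromℕ (suc (suc n)))
    last-if-q>0 q>0 = mixed-determined (mixed-face e true (fromℕ (suc (suc n))) (λ ()) (λ _ → q>0))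
                        (below false true zero last′ z≤n first)
                        (below false true last′ last′ ≤-refl (middle false (fromℕ n)))

    agrees-at-suc : Agrees true (fromℕ (suc (suc n))) → ∀ k j → Agrees k (suc j)
    agrees-at-suc agree-last k j with view j | k
    ... | ‵inject₁ j′ | k′    = middle k′ j′
    ... | ‵fromℕ      | false = last
    ... | ‵fromℕ      | true  = agree-last

    agrees-at-inject₁ : Agrees true zero → ∀ k j → Agrees k (inject₁ j)
    agrees-at-inject₁ agree-first false zero    = first
    agrees-at-inject₁ agree-first true  zero    = agree-first
    agrees-at-inject₁ agree-first k     (suc j) = middle k j

    p>0⊎q>0 : 0 < p ⊎ 0 < q
    p>0⊎q>0 = summand-positive p q (suc-injective (suc-injective (trans (sym (+-suc (suc p) q)) e)))

    hm3 : HM3 (A ⊗ B)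
    hm3 = hm3-⊗ hA.hm3 hB.hm3

    agrees-first : Agrees true zero
    agrees-first = [ first-if-p>0 , via-faces ]′ p>0⊎q>0
      where
      via-faces : 0 < q → Agrees true zero
      via-faces q>0 = hm3 n (∂α true zero) (g true zero) λ k j →
        above true k zero j z≤n (agrees-at-suc (last-if-q>0 q>0) k j)

    agrees-last : Agrees true (fromℕ (suc (suc n)))
    agrees-last = [ via-faces , last-if-q>0 ]′ p>0⊎q>0
      where
      via-faces : 0 < p → Agrees true (fromℕ (suc (suc n)))
      via-faces p>0 = hm3 n (∂α true (fromℕ (suc (suc n)))) (g true (fromℕ (suc (suc n)))) λ k j →
        below k true j last′ (≤fromℕ j) (agrees-at-inject₁ (first-if-p>0 p>0) k j)

    agrees : ∀ k i → Agrees k i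
    agrees false zero    = first
    agrees true  zero    = agrees-first
    agrees k     (suc j) = agrees-at-suc agrees-last k j

    filler : Filler (A ⊗ B) g
    filler = α , agrees

  shell-fillable : ∀ {n} (g : Shell (A ⊗ B) (suc n)) → IsShell (A ⊗ B) g → ¬ ¬ Filler (A ⊗ B) g
  shell-fillable {n} g shell
    with shell-kind (g false zero) (g false (fromℕ (suc (suc n)))) (shell false false zero (fromℕ (suc n)) z≤n)
  ... | pureˡ w γ₀ = pureˡ-fillable g shell w (Pureˡ-shell g shell γ₀) tt
  ... | pureʳ v γₗ = pureʳ-fillable g shell v (Pureʳ-shell g shell γₗ) tt
  ... | mixed e a b first last = λ ¬fill → ¬fill (MixedFiller.filler g shell e a b first last)

  fillsShells-⊗ : FillsShells (S ||| T) (A ⊗ B)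
  fillsShells-⊗ {zero} g shell wl =
    ¬¬-map (Filler-resp {D = A ⊗ B} (λ k i → sym (g≡ k i)))
      (square-fillable (g false zero) (g false (suc zero)) (g true zero) (g true (suc zero))
        (IsShell-resp {D = A ⊗ B} g≡ shell) (WellLabelled-resp {X = S ||| T} {D = A ⊗ B} g≡ wl))
    where
    g≡ : ∀ k i → g k i ≡ square (A ⊗ B) (g false zero) (g false (suc zero)) (g true zero) (g true (suc zero)) k i
    g≡ = square-η g
  fillsShells-⊗ {suc n} g shell _ = shell-fillable g shell

theorem5p9 : (S T : LTS) (A : RawHDA (LTS.Lab S)) (B : RawHDA (LTS.Lab T)) →
             IsHDAModel S A → IsHDAModel T B →
             IsHDAModel (S ||| T) (A ⊗ B)
theorem5p9 S T A B hA hB = record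
  { isHDA = isHDA-⊗ (IsHDAModel.isHDA hA) (IsHDAModel.isHDA hB)
  ; hm1   = hm1-⊗
  ; hm2   = hm2-⊗
  ; hm3   = hm3-⊗ (IsHDAModel.hm3 hA) (IsHDAModel.hm3 hB)
  ; hm4   = fillsShells⇒hm4 hm1-⊗ fillsShells-⊗ }
  where
  open Tensor A B
  open TensorOfModels S T A B hA hB
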